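{- Let $a,b\ge 2$ be integers and $n\ge 9$. Let $r=a$, $s=b$ if $n$ is even and $r=b$, $s=a$ if $n$ is odd, and suppose $r$ is odd and $s$ is even. Write $F=f_{(a,b,n-3)}$, $G=f_{(a,b,n-4)}$, $T=t_{(a,b,n-4)}$, and set $$B = \left(F^2\right)^{(r+1)/2} T \left(F^2\right)^{(r-1)/2} G,\qquad C = \left(F^2\right)^{(r+1)/2} G,\qquad D = \left(F^2\right)^{(r+1)/2} T.$$ Then $$f_{(a,b,n)} = \left\{ B^{s/2}\, C\, B^{(s-2)/2}\, D \right\}^{(r-1)/2} B^{s/2}\, C.$$
   Context: Words are over the alphabet $\{0,1\}$, with concatenation as the product; $w^k$ denotes the concatenation of $k$ copies of $w$ ($w^0$ is the empty word). For integers $a,b\ge 1$ the biperiodic Fibonacci words are defined by $f_{(a,b,0)}=0$, $f_{(a,b,1)}=0^{a-1}1$, and for $n\ge 2$: $f_{(a,b,n)} = f_{(a,b,n-1)}^{a}f_{(a,b,n-2)}$ if $n$ is even, and $f_{(a,b,n)} = f_{(a,b,n-1)}^{b}f_{(a,b,n-2)}$ if $n$ is odd. For a word $f_{(a,b,n)}$ with at least two letters, write $f_{(a,b,n)} = p\,xy$ with $x,y$ letters; then $t_{(a,b,n)} := p\,yx$ is $f_{(a,b,n)}$ with its last two letters interchanged. -}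

module Defs where

open import Data.Nat using (ℕ; zero; suc; _+_; _*_; _∸_; _%_)
open import Data.Nat.Properties using (_≟_)
open import Data.Bool using (Bool; true; false; if_then_else_)
open import Data.List using (List; []; _∷_; _++_; [_])
open import Relation.Nullary.Decidable using (⌊_⌋)

data Letter : Set where
  𝟎 𝟏 : Letter

Word : Set
Word = List Letter

_^w_ : Word → ℕ → Word
w ^w zero = []
w ^w suc k = w ++ (w ^w k)

isEven : ℕ → Bool
isEven n = ⌊ n % 2 ≟ 0 ⌋

fib : ℕ → ℕ → ℕ → Word
fib a b zero = 𝟎 ∷ []
fib a b (suc zero) = (𝟎 ∷ []) ^w (a ∸ 1) ++ (𝟏 ∷ [])
fib a b (suc (suc n)) =
  (fib a b (suc n) ^w (if isEven (suc (suc n)) then a else b)) ++ fib a b n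

swapLast2 : Word → Word
swapLast2 [] = []
swapLast2 (x ∷ []) = x ∷ []
swapLast2 (x ∷ y ∷ []) = y ∷ x ∷ []
swapLast2 (x ∷ y ∷ z ∷ w) = x ∷ swapLast2 (y ∷ z ∷ w)

tw : ℕ → ℕ → ℕ → Word
tw a b n = swapLast2 (fib a b n)

rOf : ℕ → ℕ → ℕ → ℕ
rOf a b n = if isEven n then a else b

sOf : ℕ → ℕ → ℕ → ℕ
sOf a b n = if isEven n then b else a

-- With F = f(n-3), G = f(n-4) and H = f(n-2), the recursion gives H = F^r G,
-- f(n-1) = H^s F and f(n) = (H^s F)^r H.  The only relation between F and G that is
-- needed is the near-commutation G F = F T.  It comes from f(j) f(j+1) = t(f(j+1) f(j)),
-- where t swaps the last two letters, which holds for every j by induction because t is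
-- an involution that commutes with prepending.  With P = (F F)^((r-1)/2) one then gets
-- H = F P G, H H = B, F H = C and H F = D; so H commutes with B, and grouping
-- (B^(s/2) F)^r H into pairs of factors B^(s/2) F yields the formula.
module Submission where

open import Defs
open import Level using (0ℓ)
open import Algebra.Bundles using (Monoid)
open import Data.Nat using (ℕ; zero; suc; _+_; _*_; _∸_; _≤_; s≤s; z≤n)
open import Data.Nat.Properties using (+-suc; +-mono-≤; ≤-trans)
open import Data.Bool using (true; false; if_then_else_)
open import Data.List using ([]; _∷_; _++_; length)
open import Data.List.Properties
  using (++-assoc; ++-identityʳ; ++-monoid; length-++; length-++-≤ˡ; length-++-≤ʳ)
open import Data.Empty using (⊥-elim)
open import Relation.Binary.PropositionalEquality
open import Tactic.MonoidSolver using (solve)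

open ≡-Reasoning

private
  words : Monoid 0ℓ 0ℓ
  words = ++-monoid Letter

^w-+ : ∀ (w : Word) i j → w ^w (i + j) ≡ w ^w i ++ w ^w j
^w-+ w zero    j = refl
^w-+ w (suc i) j = trans (cong (w ++_) (^w-+ w i j)) (sym (++-assoc w _ _))

^w-double : ∀ (w : Word) k → w ^w (2 * k) ≡ (w ++ w) ^w k
^w-double w zero    = refl
^w-double w (suc k) = begin
  w ^w (2 * suc k)          ≡⟨ cong (λ e → w ^w suc e) (+-suc k (k + 0)) ⟩
  w ++ w ++ w ^w (2 * k)    ≡⟨ cong (λ u → w ++ w ++ u) (^w-double w k) ⟩
  w ++ w ++ (w ++ w) ^w k   ≡⟨ sym (++-assoc w w _) ⟩
  (w ++ w) ^w suc k         ∎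

^w-odd : ∀ (w : Word) k → w ^w (2 * k + 1) ≡ (w ++ w) ^w k ++ w
^w-odd w k = begin
  w ^w (2 * k + 1)          ≡⟨ ^w-+ w (2 * k) 1 ⟩
  w ^w (2 * k) ++ w ++ []   ≡⟨ cong₂ _++_ (^w-double w k) (++-identityʳ w) ⟩
  (w ++ w) ^w k ++ w        ∎

++-comm-^w : ∀ (x y : Word) → x ++ y ≡ y ++ x → ∀ j → x ++ y ^w j ≡ y ^w j ++ x
++-comm-^w x y xy≡yx zero    = ++-identityʳ x
++-comm-^w x y xy≡yx (suc j) = begin
  x ++ y ++ y ^w j     ≡⟨ sym (++-assoc x y _) ⟩
  (x ++ y) ++ y ^w j   ≡⟨ cong (_++ y ^w j) xy≡yx ⟩
  (y ++ x) ++ y ^w j   ≡⟨ ++-assoc y x _ ⟩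
  y ++ x ++ y ^w j     ≡⟨ cong (y ++_) (++-comm-^w x y xy≡yx j) ⟩
  y ++ y ^w j ++ x     ≡⟨ sym (++-assoc y _ x) ⟩
  (y ++ y ^w j) ++ x   ∎

++-comm-^w-self : ∀ (w : Word) j → w ++ w ^w j ≡ w ^w j ++ w
++-comm-^w-self w = ++-comm-^w w w refl

length-++-≥2 : ∀ (x : Word) {y} → 1 ≤ length x → 1 ≤ length y → 2 ≤ length (x ++ y)
length-++-≥2 x 1≤∣x∣ 1≤∣y∣ = subst (2 ≤_) (sym (length-++ x)) (+-mono-≤ 1≤∣x∣ 1≤∣y∣)

length-swapLast2 : ∀ w → length (swapLast2 w) ≡ length w
length-swapLast2 []              = refl
length-swapLast2 (x ∷ [])        = refl
length-swapLast2 (x ∷ y ∷ [])    = refl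
length-swapLast2 (x ∷ y ∷ z ∷ w) = cong suc (length-swapLast2 (y ∷ z ∷ w))

swapLast2-∷ : ∀ c {w} → 2 ≤ length w → swapLast2 (c ∷ w) ≡ c ∷ swapLast2 w
swapLast2-∷ c {u ∷ []}    (s≤s ())
swapLast2-∷ c {u ∷ v ∷ w} _        = refl

swapLast2-++ : ∀ (x : Word) {y} → 2 ≤ length y → swapLast2 (x ++ y) ≡ x ++ swapLast2 y
swapLast2-++ []      2≤∣y∣ = refl
swapLast2-++ (c ∷ x) 2≤∣y∣ =
  trans (swapLast2-∷ c (≤-trans 2≤∣y∣ (length-++-≤ʳ _ {x})))
        (cong (c ∷_) (swapLast2-++ x 2≤∣y∣))

swapLast2-involutive : ∀ w → swapLast2 (swapLast2 w) ≡ w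
swapLast2-involutive []              = refl
swapLast2-involutive (x ∷ [])        = refl
swapLast2-involutive (x ∷ y ∷ [])    = refl
swapLast2-involutive (x ∷ y ∷ z ∷ w) = begin
  swapLast2 (x ∷ swapLast2 (y ∷ z ∷ w))
    ≡⟨ swapLast2-∷ x (subst (2 ≤_) (sym (length-swapLast2 (y ∷ z ∷ w))) (s≤s (s≤s z≤n))) ⟩
  x ∷ swapLast2 (swapLast2 (y ∷ z ∷ w))
    ≡⟨ cong (x ∷_) (swapLast2-involutive (y ∷ z ∷ w)) ⟩
  x ∷ y ∷ z ∷ w ∎

length-fib-≥1 : ∀ a b n → 1 ≤ length (fib a b n)
length-fib-≥1 a b zero          = s≤s z≤n
length-fib-≥1 a b (suc zero)    = length-++-≤ʳ (𝟏 ∷ []) {(𝟎 ∷ []) ^w (a ∸ 1)}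
length-fib-≥1 a b (suc (suc n)) =
  ≤-trans (length-fib-≥1 a b n) (length-++-≤ʳ (fib a b n) {fib a b (suc n) ^w e})
  where
  e = if isEven (2 + n) then a else b

length-fib-≥2 : ∀ a b n → 2 ≤ length (fib (suc a) (suc b) (2 + n))
length-fib-≥2 a b n =
  length-++-≥2 (f ^w e) (length-power (isEven (2 + n))) (length-fib-≥1 (suc a) (suc b) n)
  where
  f = fib (suc a) (suc b) (1 + n)
  e = if isEven (2 + n) then suc a else suc b
  length-power : ∀ c → 1 ≤ length (f ^w (if c then suc a else suc b))
  length-power true  = ≤-trans (length-fib-≥1 (suc a) (suc b) (1 + n)) (length-++-≤ˡ f)
  length-power false = ≤-trans (length-fib-≥1 (suc a) (suc b) (1 + n)) (length-++-≤ˡ f)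

fib-++-swapLast2 : ∀ a b j → fib a b j ++ fib a b (suc j) ≡ swapLast2 (fib a b (suc j) ++ fib a b j)
fib-++-swapLast2 a b zero = sym (begin
  swapLast2 ((z ++ 𝟏 ∷ []) ++ 𝟎 ∷ [])  ≡⟨ cong swapLast2 (++-assoc z (𝟏 ∷ []) (𝟎 ∷ [])) ⟩
  swapLast2 (z ++ 𝟏 ∷ 𝟎 ∷ [])          ≡⟨ swapLast2-++ z (s≤s (s≤s z≤n)) ⟩
  z ++ 𝟎 ∷ 𝟏 ∷ []                      ≡⟨ sym (++-assoc z (𝟎 ∷ []) (𝟏 ∷ [])) ⟩
  (z ++ 𝟎 ∷ []) ++ 𝟏 ∷ []              ≡⟨ cong (_++ 𝟏 ∷ []) (sym (++-comm-^w-self (𝟎 ∷ []) (a ∸ 1))) ⟩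
  𝟎 ∷ z ++ 𝟏 ∷ []                      ∎)
  where
  z = (𝟎 ∷ []) ^w (a ∸ 1)
fib-++-swapLast2 a b (suc j) = begin
  x ++ x ^w e ++ y                     ≡⟨ sym (++-assoc x _ y) ⟩
  (x ++ x ^w e) ++ y                   ≡⟨ cong (_++ y) (++-comm-^w-self x e) ⟩
  (x ^w e ++ x) ++ y                   ≡⟨ ++-assoc _ x y ⟩
  x ^w e ++ x ++ y                     ≡⟨ cong (x ^w e ++_) (sym (swapLast2-involutive (x ++ y))) ⟩
  x ^w e ++ swapLast2 (swapLast2 (x ++ y))
    ≡⟨ cong (λ u → x ^w e ++ swapLast2 u) (sym (fib-++-swapLast2 a b j)) ⟩
  x ^w e ++ swapLast2 (y ++ x)
    ≡⟨ sym (swapLast2-++ (x ^w e) (length-++-≥2 y (length-fib-≥1 a b j) (length-fib-≥1 a b (suc j)))) ⟩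
  swapLast2 (x ^w e ++ y ++ x)         ≡⟨ cong swapLast2 (sym (++-assoc (x ^w e) y x)) ⟩
  swapLast2 ((x ^w e ++ y) ++ x)       ∎
  where
  x = fib a b (suc j)
  y = fib a b j
  e = if isEven (2 + j) then a else b

fib-near-comm : ∀ a b j → let f = fib (suc a) (suc b) in
  f (2 + j) ++ f (3 + j) ≡ f (3 + j) ++ tw (suc a) (suc b) (2 + j)
fib-near-comm a b j =
  trans (fib-++-swapLast2 (suc a) (suc b) (2 + j))
        (swapLast2-++ (fib (suc a) (suc b) (3 + j)) (length-fib-≥2 a b j))

module _ (F G T : Word) (k : ℕ) where
  private
    P H B C D : Word
    P = (F ++ F) ^w k
    H = F ++ P ++ G
    B = (F ++ F) ^w suc k ++ T ++ P ++ G
    C = (F ++ F) ^w suc k ++ G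
    D = (F ++ F) ^w suc k ++ T

    FP≡PF : F ++ P ≡ P ++ F
    FP≡PF = ++-comm-^w F (F ++ F) (sym (++-assoc F F F)) k

    F^r++G≡H : F ^w (2 * k + 1) ++ G ≡ H
    F^r++G≡H = begin
      F ^w (2 * k + 1) ++ G  ≡⟨ cong (_++ G) (^w-odd F k) ⟩
      (P ++ F) ++ G          ≡⟨ cong (_++ G) (sym FP≡PF) ⟩
      (F ++ P) ++ G          ≡⟨ ++-assoc F P G ⟩
      H                      ∎

    FH≡C : F ++ H ≡ C
    FH≡C = solve words

    module _ (GF≡FT : G ++ F ≡ F ++ T) where
      HF≡D : H ++ F ≡ D
      HF≡D = begin
        (F ++ P ++ G) ++ F   ≡⟨ solve words ⟩
        F ++ P ++ G ++ F     ≡⟨ cong (λ u → F ++ P ++ u) GF≡FT ⟩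
        F ++ P ++ F ++ T     ≡⟨ cong (F ++_) (sym (++-assoc P F T)) ⟩
        F ++ (P ++ F) ++ T   ≡⟨ cong (λ u → F ++ u ++ T) (sym FP≡PF) ⟩
        F ++ (F ++ P) ++ T   ≡⟨ solve words ⟩
        D                    ∎

      HH≡B : H ++ H ≡ B
      HH≡B = begin
        H ++ H            ≡⟨ solve words ⟩
        (H ++ F) ++ P ++ G  ≡⟨ cong (_++ P ++ G) HF≡D ⟩
        D ++ P ++ G       ≡⟨ solve words ⟩
        B                 ∎

      HB≡BH : H ++ B ≡ B ++ H
      HB≡BH = begin
        H ++ B          ≡⟨ cong (H ++_) (sym HH≡B) ⟩
        H ++ H ++ H     ≡⟨ sym (++-assoc H H H) ⟩
        (H ++ H) ++ H   ≡⟨ cong (_++ H) HH≡B ⟩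
        B ++ H          ∎

      H^2m≡B^m : ∀ m → H ^w (2 * m) ≡ B ^w m
      H^2m≡B^m m = trans (^w-double H m) (cong (_^w m) HH≡B)

      YY≡X : ∀ m → let Y = B ^w suc m ++ F in
        Y ++ Y ≡ B ^w suc m ++ C ++ B ^w m ++ D
      YY≡X m = begin
        Y ++ (B ++ B ^w m) ++ F                        ≡⟨ cong (λ u → Y ++ (u ++ B ^w m) ++ F) (sym HH≡B) ⟩
        Y ++ ((H ++ H) ++ B ^w m) ++ F                 ≡⟨ solve words ⟩
        B ^w suc m ++ (F ++ H) ++ (H ++ B ^w m) ++ F
          ≡⟨ cong₂ (λ u v → B ^w suc m ++ u ++ v ++ F) FH≡C (++-comm-^w H B HB≡BH m) ⟩
        B ^w suc m ++ C ++ (B ^w m ++ H) ++ F          ≡⟨ solve words ⟩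
        B ^w suc m ++ C ++ B ^w m ++ H ++ F            ≡⟨ cong (λ u → B ^w suc m ++ C ++ B ^w m ++ u) HF≡D ⟩
        B ^w suc m ++ C ++ B ^w m ++ D                 ∎
        where
        Y = B ^w suc m ++ F

  odd-power-blocks : ∀ m r s → G ++ F ≡ F ++ T → r ≡ 2 * k + 1 → s ≡ 2 * suc m →
    ((F ^w r ++ G) ^w s ++ F) ^w r ++ F ^w r ++ G
      ≡ (B ^w suc m ++ C ++ B ^w m ++ D) ^w k ++ B ^w suc m ++ C
  odd-power-blocks m _ _ GF≡FT refl refl = begin
    (H′ ^w (2 * suc m) ++ F) ^w (2 * k + 1) ++ H′
      ≡⟨ cong (λ h → (h ^w (2 * suc m) ++ F) ^w (2 * k + 1) ++ h) F^r++G≡H ⟩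
    (H ^w (2 * suc m) ++ F) ^w (2 * k + 1) ++ H
      ≡⟨ cong (λ u → (u ++ F) ^w (2 * k + 1) ++ H) (H^2m≡B^m GF≡FT (suc m)) ⟩
    Y ^w (2 * k + 1) ++ H                  ≡⟨ cong (_++ H) (^w-odd Y k) ⟩
    ((Y ++ Y) ^w k ++ Y) ++ H              ≡⟨ cong (λ u → (u ^w k ++ Y) ++ H) (YY≡X GF≡FT m) ⟩
    (X ^w k ++ Y) ++ H                     ≡⟨ solve words ⟩
    X ^w k ++ B ^w suc m ++ F ++ H         ≡⟨ cong (λ u → X ^w k ++ B ^w suc m ++ u) FH≡C ⟩
    X ^w k ++ B ^w suc m ++ C              ∎
    where
    H′ = F ^w (2 * k + 1) ++ G
    Y = B ^w suc m ++ F
    X = B ^w suc m ++ C ++ B ^w m ++ D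

rOf≡sOf-suc : ∀ a b n → rOf a b n ≡ sOf a b (suc n)
rOf≡sOf-suc a b zero          = refl
rOf≡sOf-suc a b (suc zero)    = refl
rOf≡sOf-suc a b (suc (suc n)) = rOf≡sOf-suc a b n

if-suc≢0 : ∀ c {p q : ℕ} → (if c then suc p else suc q) ≢ 0
if-suc≢0 true  ()
if-suc≢0 false ()

mainTheorem7 : (a b n : ℕ) → 2 ≤ a → 2 ≤ b → 9 ≤ n →
    (k m : ℕ) → rOf a b n ≡ 2 * k + 1 → sOf a b n ≡ 2 * m →
    let F = fib a b (n ∸ 3)
        G = fib a b (n ∸ 4)
        T = tw a b (n ∸ 4)
        F2 = F ++ F
        B = (F2 ^w (suc k)) ++ T ++ (F2 ^w k) ++ G
        C = (F2 ^w (suc k)) ++ G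
        D = (F2 ^w (suc k)) ++ T
    in fib a b n ≡ ((B ^w m) ++ C ++ (B ^w (m ∸ 1)) ++ D) ^w k ++ (B ^w m) ++ C
mainTheorem7 (suc (suc a)) (suc (suc b)) n@(suc (suc (suc (suc (suc (suc N))))))
             (s≤s (s≤s z≤n)) (s≤s (s≤s z≤n)) (s≤s (s≤s (s≤s (s≤s (s≤s (s≤s _))))))
             k zero _ s≡0 =
  ⊥-elim (if-suc≢0 (isEven n) s≡0)
mainTheorem7 (suc (suc a)) (suc (suc b)) n@(suc (suc (suc (suc (suc (suc N))))))
             (s≤s (s≤s z≤n)) (s≤s (s≤s z≤n)) (s≤s (s≤s (s≤s (s≤s (s≤s (s≤s _))))))
             k (suc m) r≡2k+1 s≡2m =
  odd-power-blocks (fib A B (3 + N)) (fib A B (2 + N)) (tw A B (2 + N)) k m _ _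
    (fib-near-comm (suc a) (suc b) N) r≡2k+1 (trans (rOf≡sOf-suc A B (5 + N)) s≡2m)
  where
  A = suc (suc a)
  B = suc (suc b)
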